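{- Let $p$ be an odd prime and $1\le j\le\frac{p-1}{2}$. Then $$-\phi_p(-1)(-1)^j\binom{\frac{p-1}{2}+j}{j}\binom{\frac{p-1}{2}}{j}\equiv\frac{\Gamma_p(\frac12+j)^2}{\Gamma_p(1+j)^2}\pmod{p^2}.$$
   Context: $\phi_p$ is the quadratic character mod $p$, so $\phi_p(-1)=(-1)^{(p-1)/2}$. $\Gamma_p$ is Morita's $p$-adic Gamma function: for $n\in\mathbb{N}$, $\Gamma_p(n):=(-1)^n\prod_{j<n,\,(j,p)=1}j$, extended continuously to $x\in\mathbb{Z}_p$ by $\Gamma_p(x):=\lim_{n\to x}\Gamma_p(n)$. The congruence is in $\mathbb{Z}_p$. -}

module Defs where

open import Data.Nat as ℕ using (ℕ; zero; suc)
open import Data.Nat.Divisibility using (_∣?_)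
open import Data.Integer as ℤ using (ℤ; +_; -_)
open import Data.Integer.Divisibility using () renaming (_∣_ to _∣ℤ_)
open import Relation.Nullary using (yes; no)

negOnePow : ℕ → ℤ
negOnePow zero    = + 1
negOnePow (suc n) = - negOnePow n

-- ∏_{0 ≤ i < n, p ∤ i} i   (for p prime, p ∤ i ⇔ gcd(i,p) = 1)
prodCoprime : ℕ → ℕ → ℤ
prodCoprime p zero    = + 1
prodCoprime p (suc n) with p ∣? n
... | yes _ = prodCoprime p n
... | no  _ = prodCoprime p n ℤ.* (+ n)

Γp : ℕ → ℕ → ℤ
Γp p n = negOnePow n ℤ.* prodCoprime p n

_≡_[mod_] : ℤ → ℤ → ℕ → Set
a ≡ b [mod m ] = (+ m) ∣ℤ (a ℤ.- b)

-- Natural numbers n_k = j + (p^k + 1)/2, which converge p-adically to 1/2 + j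
-- as k → ∞ (for p odd, p^k + 1 is even and 2 n_k = 2j + 1 + p^k).
halfSeq : ℕ → ℕ → ℕ → ℕ
halfSeq p j k = j ℕ.+ ((p ℕ.^ k ℕ.+ 1) ℕ./ 2)

-- Write p = 2h + 1 and, for k ≥ 2, p ^ k = 2e + 1, so that halfSeq p j k = e + 1 + j and
-- Γ_p(e + 1 + j) ^ 2 = P ^ 2 A ^ 2 with P = ∏_{i ≤ e, p ∤ i} i and A = (e + 1)(e + 2)⋯(e + j).
-- Pairing the factors x > e of Γ_p(p ^ k) with p ^ k - x, Gauss's generalisation of Wilson's theorem
-- (the units modulo p ^ k multiply to -1) gives P ^ 2 ≡ -(-1) ^ h modulo p ^ k.  Since e ≡ h modulo p
-- and p ^ 2 ∣ 2e + 1, every factor satisfies (e + 1 + i) ^ 2 ≡ -(h + 1 + i)(h - i) modulo p ^ 2, so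
-- A ^ 2 ≡ (-1) ^ j (h + 1)⋯(h + j) · h(h - 1)⋯(h - j + 1) = (-1) ^ j C(h + j, j) C(h, j) (j!) ^ 2,
-- while Γ_p(1 + j) ^ 2 = (j!) ^ 2.
module Submission where

open import Defs
open import Data.Integer as ℤ using (ℤ; +_; -_; _+_; _*_; _-_)
import Data.Integer.Divisibility.Signed as ℤ
open import Data.Integer.DivMod using (_%ℕ_; _/ℕ_; n%ℕd<d; a≡a%ℕn+[a/ℕn]*n)
import Data.Integer.Properties as ℤ
open import Data.Integer.Tactic.RingSolver using (solve-∀)
open import Data.List using (List; []; _∷_; filter; applyDownFrom; length)
open import Data.List.Membership.Propositional using (_∈_)
open import Data.List.Membership.Propositional.Properties
  using (∈-filter⁺; ∈-filter⁻; ∈-applyDownFrom⁺; ∈-applyDownFrom⁻)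
open import Data.List.Properties using (length-filter; filter-accept; filter-reject; filter-all)
import Data.List.Relation.Unary.All as All
open import Data.List.Relation.Unary.AllPairs using (_∷_)
open import Data.List.Relation.Unary.Any as Any using (here; there)
open import Data.List.Relation.Unary.Unique.Propositional using (Unique)
import Data.List.Relation.Unary.Unique.Propositional.Properties as Unique
open import Data.Nat as ℕ using (ℕ; zero; suc; _≤_; _<_; _≥_; _∸_; _/_; _^_; _!; z≤n; s≤s; NonZero)
open import Data.Nat.Combinatorics using (_C_; nCk≡nPk/k!)
open import Data.Nat.Combinatorics.Base using (_P′_; _P_)
open import Data.Nat.Combinatorics.Specification using (nP′k≡n!/[n∸k]!; nPk≡n!/[n∸k]!; k!∣nP′k; nP′k≡n[n∸1P′k∸1])
open import Data.Nat.Coprimality as Coprime using (Coprime; coprime-divisor; coprime-Bézout)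
open import Data.Nat.Divisibility as ℕ using (_∣_; _∣?_; _∣0; ∣m+n∣m⇒∣n; m∣m*n)
open import Data.Nat.DivMod using (m/n*n≡m; m*n/n≡m)
open import Data.Nat.GCD using (module Bézout)
open import Data.Nat.Induction using (<-wellFounded)
open import Data.Nat.ListAction using (product)
open import Data.Nat.Primality using (Prime; prime⇒irreducible; prime⇒nonTrivial; prime⇒nonZero; irreducible[2])
import Data.Nat.Properties as ℕ
open import Algebra.Properties.CommutativeSemigroup ℕ.*-commutativeSemigroup using (x∙yz≈y∙xz)
import Data.Nat.Tactic.RingSolver as ℕ-Solver
open import Data.Product using (∃; ∃-syntax; _×_; _,_; proj₁; proj₂)
open import Data.Sum as Sum using (_⊎_; inj₁; inj₂; [_,_]′)
open import Function using (_∘_)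
open import Induction.WellFounded using (Acc; acc)
open import Level using (0ℓ)
open import Relation.Binary.Bundles using (Setoid)
open import Relation.Binary.PropositionalEquality
import Relation.Binary.Reasoning.Setoid
open import Relation.Binary.Structures using (IsEquivalence)
open import Relation.Nullary using (¬_; ¬?; contradiction; Dec; yes; no)

-- `_≡_[mod_]` wrapped in a record, so that both sides of a congruence can be inferred from its proof.
infix 4 _≈_[mod_]
record _≈_[mod_] (a b : ℤ) (n : ℕ) : Set where
  constructor mod
  field divides-difference : + n ℤ.∣ a - b
open _≈_[mod_]

module _ {n : ℕ} where

  ≈-isEquivalence : IsEquivalence (λ a b → a ≈ b [mod n ])
  ≈-isEquivalence = record
    { refl  = λ {a} → mod (ℤ.divides (+ 0) (ℤ.+-inverseʳ a))
    ; sym   = λ {a} {b} (mod d) → mod (subst (+ n ℤ.∣_) (ring a b) (ℤ.∣m⇒∣-m d))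
    ; trans = λ {a} {b} {c} (mod d) (mod d′) → mod (subst (+ n ℤ.∣_) (ring′ a b c) (ℤ.∣m∣n⇒∣m+n d d′))
    }
    where
    ring : ∀ a b → - (a - b) ≡ b - a
    ring = solve-∀
    ring′ : ∀ a b c → (a - b) + (b - c) ≡ a - c
    ring′ = solve-∀

  open IsEquivalence ≈-isEquivalence public
    using () renaming (refl to ≈-refl; sym to ≈-sym; trans to ≈-trans; reflexive to ≈-reflexive)

≈-setoid : ℕ → Setoid 0ℓ 0ℓ
≈-setoid n = record { isEquivalence = ≈-isEquivalence {n} }

module ≈-Reasoning (n : ℕ) = Relation.Binary.Reasoning.Setoid (≈-setoid n)

module _ {n : ℕ} where

  ≈-* : ∀ {a b c d} → a ≈ b [mod n ] → c ≈ d [mod n ] → a * c ≈ b * d [mod n ]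
  ≈-* {a} {b} {c} {d} (mod d₁) (mod d₂) =
    mod (subst (+ n ℤ.∣_) (ring a b c d) (ℤ.∣m∣n⇒∣m+n (ℤ.∣n⇒∣m*n a d₂) (ℤ.∣m⇒∣m*n d d₁)))
    where
    ring : ∀ a b c d → a * (c - d) + (a - b) * d ≡ a * c - b * d
    ring = solve-∀

  ≈-*ˡ : ∀ c {a b} → a ≈ b [mod n ] → c * a ≈ c * b [mod n ]
  ≈-*ˡ c = ≈-* (≈-refl {x = c})

  ≈-*ʳ : ∀ c {a b} → a ≈ b [mod n ] → a * c ≈ b * c [mod n ]
  ≈-*ʳ c a≈b = ≈-* a≈b (≈-refl {x = c})

  ≈-neg : ∀ {a b} → a ≈ b [mod n ] → - a ≈ - b [mod n ]
  ≈-neg {a} {b} (mod d) = mod (subst (+ n ℤ.∣_) (ring a b) (ℤ.∣m⇒∣-m d))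
    where
    ring : ∀ a b → - (a - b) ≡ - a - - b
    ring = solve-∀

≈-weaken : ∀ {m n a b} → m ∣ n → a ≈ b [mod n ] → a ≈ b [mod m ]
≈-weaken m∣n (mod d) = mod (ℤ.∣-trans (ℤ.∣ᵤ⇒∣ m∣n) d)

≈⇒≡[mod] : ∀ {n a b} → a ≈ b [mod n ] → a ≡ b [mod n ]
≈⇒≡[mod] (mod d) = ℤ.∣⇒∣ᵤ d

≈-%ℕ : ∀ n .{{_ : NonZero n}} t → + (t %ℕ n) ≈ t [mod n ]
≈-%ℕ n t = mod (ℤ.divides (- (t /ℕ n)) (begin
  + (t %ℕ n) - t                                ≡⟨ cong (λ t′ → + (t %ℕ n) - t′) (a≡a%ℕn+[a/ℕn]*n t n) ⟩
  + (t %ℕ n) - (+ (t %ℕ n) + (t /ℕ n) * + n)    ≡⟨ ring (+ (t %ℕ n)) (t /ℕ n) (+ n) ⟩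
  - (t /ℕ n) * + n                              ∎))
  where
  open ≡-Reasoning
  ring : ∀ r q n → r - (r + q * n) ≡ - q * n
  ring = solve-∀

≈-residue-unique : ∀ {n a b} → a < n → b < n → + a ≈ + b [mod n ] → a ≡ b
≈-residue-unique {n} {a} {b} a<n b<n (mod d) with ℤ.∣ a ℤ.⊖ b ∣ in eq
... | zero  = ℤ.+-injective (ℤ.i-j≡0⇒i≡j (+ a) (+ b) (ℤ.∣i∣≡0⇒i≡0 (trans (cong ℤ.∣_∣ (ℤ.m-n≡m⊖n a b)) eq)))
... | suc δ = contradiction (subst (n ∣_) (trans (cong ℤ.∣_∣ (ℤ.m-n≡m⊖n a b)) eq) (ℤ.∣⇒∣ᵤ d)) (ℕ.>⇒∤ δ<n)
  where
  δ<n : suc δ < n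
  δ<n = subst (_< n) eq (ℕ.≤-<-trans (ℤ.∣m⊝n∣≤m⊔n a b) (ℕ.⊔-lub a<n b<n))

Π : ℕ → (ℕ → ℤ) → ℤ
Π zero    f = + 1
Π (suc n) f = Π n f * f n

Π-* : ∀ n f g → Π n f * Π n g ≡ Π n (λ i → f i * g i)
Π-* zero    f g = refl
Π-* (suc n) f g = trans (ring (Π n f) (f n) (Π n g) (g n)) (cong (_* (f n * g n)) (Π-* n f g))
  where
  ring : ∀ a b c d → a * b * (c * d) ≡ a * c * (b * d)
  ring = solve-∀

Π-cong-≈ : ∀ {m} n {f g} → (∀ i → i < n → f i ≈ g i [mod m ]) → Π n f ≈ Π n g [mod m ]
Π-cong-≈ zero    f≈g = ≈-refl
Π-cong-≈ (suc n) f≈g = ≈-* (Π-cong-≈ n (λ i i<n → f≈g i (ℕ.m≤n⇒m≤1+n i<n))) (f≈g n ℕ.≤-refl)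

negOnePow≡Π : ∀ n → negOnePow n ≡ Π n (λ _ → - + 1)
negOnePow≡Π zero    = refl
negOnePow≡Π (suc n) = trans (ring (negOnePow n)) (cong (_* - + 1) (negOnePow≡Π n))
  where
  ring : ∀ x → - x ≡ x * - + 1
  ring = solve-∀

negOnePow-square : ∀ n → negOnePow n * negOnePow n ≡ + 1
negOnePow-square zero    = refl
negOnePow-square (suc n) = trans (ring (negOnePow n)) (negOnePow-square n)
  where
  ring : ∀ x → - x * - x ≡ x * x
  ring = solve-∀

negOnePow-+ : ∀ m n → negOnePow (m ℕ.+ n) ≡ negOnePow m * negOnePow n
negOnePow-+ zero    n = sym (ℤ.*-identityˡ (negOnePow n))
negOnePow-+ (suc m) n = trans (cong -_ (negOnePow-+ m n)) (ℤ.neg-distribˡ-* (negOnePow m) (negOnePow n))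

negOnePow-even : ∀ n → negOnePow (2 ℕ.* n) ≡ + 1
negOnePow-even n = begin
  negOnePow (n ℕ.+ (n ℕ.+ 0))   ≡⟨ cong (λ m → negOnePow (n ℕ.+ m)) (ℕ.+-identityʳ n) ⟩
  negOnePow (n ℕ.+ n)           ≡⟨ negOnePow-+ n n ⟩
  negOnePow n * negOnePow n     ≡⟨ negOnePow-square n ⟩
  + 1                           ∎
  where open ≡-Reasoning

nCk*k!≡nP′k : ∀ {n k} → k ≤ n → (n C k) ℕ.* k ! ≡ n P′ k
nCk*k!≡nP′k {n} {k} k≤n = begin
  (n C k) ℕ.* k !            ≡⟨ cong (ℕ._* k !) (nCk≡nPk/k! k≤n) ⟩
  ((n P k) / k !) ℕ.* k !    ≡⟨ cong (λ m → (m / k !) ℕ.* k !) (trans (nPk≡n!/[n∸k]! k≤n) (sym (nP′k≡n!/[n∸k]! k≤n))) ⟩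
  ((n P′ k) / k !) ℕ.* k !   ≡⟨ m/n*n≡m (k!∣nP′k k≤n) ⟩
  n P′ k                     ∎
  where
  open ≡-Reasoning
  instance _ = k ℕ.!≢0

P′≡Π-falling : ∀ n k → + (n P′ k) ≡ Π k (λ i → + (n ∸ i))
P′≡Π-falling n zero    = refl
P′≡Π-falling n (suc k) =
  trans (ℤ.pos-* (n ∸ k) (n P′ k)) (trans (ℤ.*-comm (+ (n ∸ k)) _) (cong (_* + (n ∸ k)) (P′≡Π-falling n k)))

P′≡Π-rising : ∀ n k → + ((n ℕ.+ k) P′ k) ≡ Π k (λ i → + (suc n ℕ.+ i))
P′≡Π-rising n zero    = refl
P′≡Π-rising n (suc k) = begin
  + ((n ℕ.+ suc k) P′ suc k)              ≡⟨ cong (λ m → + (m P′ suc k)) (ℕ.+-suc n k) ⟩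
  + (suc (n ℕ.+ k) P′ suc k)              ≡⟨ cong +_ (nP′k≡n[n∸1P′k∸1] (suc (n ℕ.+ k)) (suc k)) ⟩
  + (suc (n ℕ.+ k) ℕ.* ((n ℕ.+ k) P′ k))  ≡⟨ trans (ℤ.pos-* (suc (n ℕ.+ k)) _) (ℤ.*-comm (+ suc (n ℕ.+ k)) _) ⟩
  + ((n ℕ.+ k) P′ k) * + (suc n ℕ.+ k)    ≡⟨ cong (_* + (suc n ℕ.+ k)) (P′≡Π-rising n k) ⟩
  Π (suc k) (λ i → + (suc n ℕ.+ i))       ∎
  where open ≡-Reasoning

C*!≡Π-rising : ∀ n k → + ((n ℕ.+ k) C k) * + (k !) ≡ Π k (λ i → + (suc n ℕ.+ i))
C*!≡Π-rising n k =
  trans (sym (ℤ.pos-* ((n ℕ.+ k) C k) (k !))) (trans (cong +_ (nCk*k!≡nP′k (ℕ.m≤n+m k n))) (P′≡Π-rising n k))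

C*!≡Π-falling : ∀ {n k} → k ≤ n → + (n C k) * + (k !) ≡ Π k (λ i → + (n ∸ i))
C*!≡Π-falling {n} {k} k≤n =
  trans (sym (ℤ.pos-* (n C k) (k !))) (trans (cong +_ (nCk*k!≡nP′k k≤n)) (P′≡Π-falling n k))

module _ {p : ℕ} where

  prodCoprime-suc-∣ : ∀ {n} → p ∣ n → prodCoprime p (suc n) ≡ prodCoprime p n
  prodCoprime-suc-∣ {n} p∣n with p ∣? n
  ... | yes _   = refl
  ... | no  p∤n = contradiction p∣n p∤n

  prodCoprime-suc-∤ : ∀ {n} → ¬ p ∣ n → prodCoprime p (suc n) ≡ prodCoprime p n * + n
  prodCoprime-suc-∤ {n} p∤n with p ∣? n
  ... | yes p∣n = contradiction p∣n p∤n
  ... | no  _   = refl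

  prodCoprime-+ : ∀ m n → (∀ i → i < n → ¬ p ∣ m ℕ.+ i) →
                  prodCoprime p (m ℕ.+ n) ≡ prodCoprime p m * Π n (λ i → + (m ℕ.+ i))
  prodCoprime-+ m zero    _    = trans (cong (prodCoprime p) (ℕ.+-identityʳ m)) (sym (ℤ.*-identityʳ _))
  prodCoprime-+ m (suc n) p∤m+ = begin
    prodCoprime p (m ℕ.+ suc n)                               ≡⟨ cong (prodCoprime p) (ℕ.+-suc m n) ⟩
    prodCoprime p (suc (m ℕ.+ n))                             ≡⟨ prodCoprime-suc-∤ (p∤m+ n ℕ.≤-refl) ⟩
    prodCoprime p (m ℕ.+ n) * + (m ℕ.+ n)                     ≡⟨ cong (_* + (m ℕ.+ n)) (prodCoprime-+ m n (λ i i<n → p∤m+ i (ℕ.m≤n⇒m≤1+n i<n))) ⟩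
    prodCoprime p m * Π n (λ i → + (m ℕ.+ i)) * + (m ℕ.+ n)   ≡⟨ ℤ.*-assoc (prodCoprime p m) _ _ ⟩
    prodCoprime p m * Π (suc n) (λ i → + (m ℕ.+ i))           ∎
    where open ≡-Reasoning

  prodCoprime≡! : ∀ {n} → n < p → prodCoprime p (suc n) ≡ + (n !)
  prodCoprime≡! {zero}  _   = prodCoprime-suc-∣ (p ∣0)
  prodCoprime≡! {suc n} n<p = begin
    prodCoprime p (suc (suc n))       ≡⟨ prodCoprime-suc-∤ (ℕ.>⇒∤ n<p) ⟩
    prodCoprime p (suc n) * + suc n   ≡⟨ cong (_* + suc n) (prodCoprime≡! (ℕ.<-trans (ℕ.n<1+n n) n<p)) ⟩
    + (n !) * + suc n                 ≡⟨ trans (ℤ.*-comm (+ (n !)) (+ suc n)) (sym (ℤ.pos-* (suc n) (n !))) ⟩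
    + (suc n !)                       ∎
    where open ≡-Reasoning

Γp-square : ∀ p n → Γp p n * Γp p n ≡ prodCoprime p n * prodCoprime p n
Γp-square p n = begin
  Γp p n * Γp p n                                                   ≡⟨ ring (negOnePow n) (prodCoprime p n) ⟩
  negOnePow n * negOnePow n * (prodCoprime p n * prodCoprime p n)   ≡⟨ cong (_* (prodCoprime p n * prodCoprime p n)) (negOnePow-square n) ⟩
  + 1 * (prodCoprime p n * prodCoprime p n)                         ≡⟨ ℤ.*-identityˡ _ ⟩
  prodCoprime p n * prodCoprime p n                                 ∎
  where
  open ≡-Reasoning
  ring : ∀ s a → s * a * (s * a) ≡ s * s * (a * a)
  ring = solve-∀

prodCoprimeNeg : ℕ → ℕ → ℤ
prodCoprimeNeg p zero    = + 1
prodCoprimeNeg p (suc n) with p ∣? n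
... | yes _ = prodCoprimeNeg p n
... | no  _ = prodCoprimeNeg p n * - + n

module _ {p : ℕ} where

  prodCoprimeNeg-suc-∣ : ∀ {n} → p ∣ n → prodCoprimeNeg p (suc n) ≡ prodCoprimeNeg p n
  prodCoprimeNeg-suc-∣ {n} p∣n with p ∣? n
  ... | yes _   = refl
  ... | no  p∤n = contradiction p∣n p∤n

  prodCoprimeNeg-suc-∤ : ∀ {n} → ¬ p ∣ n → prodCoprimeNeg p (suc n) ≡ prodCoprimeNeg p n * - + n
  prodCoprimeNeg-suc-∤ {n} p∤n with p ∣? n
  ... | yes p∣n = contradiction p∣n p∤n
  ... | no  _   = refl

  -- Modulo M, a factor x ≥ m of prodCoprime p M is the negative of M - x, and M - x runs over [1, n].
  prodCoprime-reflect : ∀ {M} → p ∣ M → ∀ m n → m ℕ.+ n ≡ M →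
                        prodCoprime p M ≈ prodCoprime p m * prodCoprimeNeg p (suc n) [mod M ]
  prodCoprime-reflect {M} p∣M m zero m+0≡M = ≈-reflexive (begin
    prodCoprime p M                        ≡⟨ cong (prodCoprime p) (trans (sym m+0≡M) (ℕ.+-identityʳ m)) ⟩
    prodCoprime p m                        ≡⟨ sym (ℤ.*-identityʳ _) ⟩
    prodCoprime p m * + 1                  ≡⟨ cong (prodCoprime p m *_) (sym (prodCoprimeNeg-suc-∣ (p ∣0))) ⟩
    prodCoprime p m * prodCoprimeNeg p 1   ∎)
    where open ≡-Reasoning
  prodCoprime-reflect {M} p∣M m (suc n) m+1+n≡M = begin
    prodCoprime p M                                    ≈⟨ prodCoprime-reflect p∣M (suc m) n (trans (sym (ℕ.+-suc m n)) m+1+n≡M) ⟩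
    prodCoprime p (suc m) * prodCoprimeNeg p (suc n)   ≈⟨ step (p ∣? m) ⟩
    prodCoprime p m * prodCoprimeNeg p (suc (suc n))   ∎
    where
    open ≈-Reasoning M
    p∣m+1+n : p ∣ m ℕ.+ suc n
    p∣m+1+n = subst (p ∣_) (sym m+1+n≡M) p∣M
    m≈-[1+n] : + m ≈ - + suc n [mod M ]
    m≈-[1+n] = mod (ℤ.divides (+ 1) (trans (cong +_ m+1+n≡M) (sym (ℤ.*-identityˡ (+ M)))))
    step : Dec (p ∣ m) →
           prodCoprime p (suc m) * prodCoprimeNeg p (suc n) ≈ prodCoprime p m * prodCoprimeNeg p (suc (suc n)) [mod M ]
    step (yes p∣m) = ≈-reflexive (cong₂ _*_ (prodCoprime-suc-∣ p∣m) (sym (prodCoprimeNeg-suc-∣ (∣m+n∣m⇒∣n p∣m+1+n p∣m))))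
    step (no  p∤m) = begin
      prodCoprime p (suc m) * prodCoprimeNeg p (suc n)           ≡⟨ cong (_* prodCoprimeNeg p (suc n)) (prodCoprime-suc-∤ p∤m) ⟩
      prodCoprime p m * + m * prodCoprimeNeg p (suc n)           ≈⟨ ≈-*ʳ (prodCoprimeNeg p (suc n)) (≈-*ˡ (prodCoprime p m) m≈-[1+n]) ⟩
      prodCoprime p m * - + suc n * prodCoprimeNeg p (suc n)     ≡⟨ ring (prodCoprime p m) (- + suc n) (prodCoprimeNeg p (suc n)) ⟩
      prodCoprime p m * (prodCoprimeNeg p (suc n) * - + suc n)   ≡⟨ cong (prodCoprime p m *_) (sym (prodCoprimeNeg-suc-∤ p∤1+n)) ⟩
      prodCoprime p m * prodCoprimeNeg p (suc (suc n))           ∎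
      where
      p∤1+n : ¬ p ∣ suc n
      p∤1+n p∣1+n = p∤m (∣m+n∣m⇒∣n (subst (p ∣_) (ℕ.+-comm m (suc n)) p∣m+1+n) p∣1+n)
      ring : ∀ a x b → a * x * b ≡ a * (b * x)
      ring = solve-∀

∤-*+ : ∀ {p r} q → 0 < r → r < p → ¬ p ∣ p ℕ.* q ℕ.+ r
∤-*+ {r = suc r} q _ r<p p∣pq+r = ℕ.>⇒∤ r<p (∣m+n∣m⇒∣n p∣pq+r (m∣m*n q))

-- Of the numbers below p q + r + 1 exactly (p - 1) q + r are prime to p: an even count plus r.
prodCoprimeNeg-odd : ∀ {p h} → p ≡ suc (2 ℕ.* h) → ∀ q r → r < p →
                     prodCoprimeNeg p (suc (p ℕ.* q ℕ.+ r)) ≡ negOnePow r * prodCoprime p (suc (p ℕ.* q ℕ.+ r))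
prodCoprimeNeg-odd {p} p≡ zero zero _ rewrite ℕ.*-zeroʳ p =
  trans (prodCoprimeNeg-suc-∣ (p ∣0)) (sym (trans (ℤ.*-identityˡ _) (prodCoprime-suc-∣ (p ∣0))))
prodCoprimeNeg-odd {p} {h} p≡ (suc q) zero _ rewrite ℕ.+-identityʳ (p ℕ.* suc q) = begin
  prodCoprimeNeg p (suc (p ℕ.* suc q))          ≡⟨ cong (prodCoprimeNeg p ∘ suc) p[1+q]≡1+n ⟩
  prodCoprimeNeg p (suc (suc n))                ≡⟨ prodCoprimeNeg-suc-∣ p∣1+n ⟩
  prodCoprimeNeg p (suc n)                      ≡⟨ prodCoprimeNeg-odd {h = h} p≡ q (2 ℕ.* h) 2h<p ⟩
  negOnePow (2 ℕ.* h) * prodCoprime p (suc n)   ≡⟨ cong (_* prodCoprime p (suc n)) (negOnePow-even h) ⟩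
  + 1 * prodCoprime p (suc n)                   ≡⟨ cong (+ 1 *_) (sym (prodCoprime-suc-∣ p∣1+n)) ⟩
  + 1 * prodCoprime p (suc (suc n))             ≡⟨ cong (λ m → + 1 * prodCoprime p (suc m)) (sym p[1+q]≡1+n) ⟩
  + 1 * prodCoprime p (suc (p ℕ.* suc q))       ∎
  where
  open ≡-Reasoning
  n = p ℕ.* q ℕ.+ 2 ℕ.* h
  p[1+q]≡1+n : p ℕ.* suc q ≡ suc n
  p[1+q]≡1+n = trans (ℕ.*-suc p q) (trans (ℕ.+-comm p (p ℕ.* q)) (trans (cong (p ℕ.* q ℕ.+_) p≡) (ℕ.+-suc (p ℕ.* q) (2 ℕ.* h))))
  p∣1+n : p ∣ suc n
  p∣1+n = subst (p ∣_) p[1+q]≡1+n (m∣m*n (suc q))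
  2h<p : 2 ℕ.* h < p
  2h<p = subst (2 ℕ.* h <_) (sym p≡) ℕ.≤-refl
prodCoprimeNeg-odd {p} {h} p≡ q (suc r) 1+r<p rewrite ℕ.+-suc (p ℕ.* q) r = begin
  prodCoprimeNeg p (suc (suc n))                      ≡⟨ prodCoprimeNeg-suc-∤ p∤1+n ⟩
  prodCoprimeNeg p (suc n) * - + suc n                ≡⟨ cong (_* - + suc n) (prodCoprimeNeg-odd {h = h} p≡ q r (ℕ.<-trans (ℕ.n<1+n r) 1+r<p)) ⟩
  negOnePow r * prodCoprime p (suc n) * - + suc n     ≡⟨ ring (negOnePow r) (prodCoprime p (suc n)) (+ suc n) ⟩
  - negOnePow r * (prodCoprime p (suc n) * + suc n)   ≡⟨ cong (- negOnePow r *_) (sym (prodCoprime-suc-∤ p∤1+n)) ⟩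
  - negOnePow r * prodCoprime p (suc (suc n))         ∎
  where
  open ≡-Reasoning
  n = p ℕ.* q ℕ.+ r
  p∤1+n : ¬ p ∣ suc n
  p∤1+n = subst (λ m → ¬ p ∣ m) (ℕ.+-suc (p ℕ.* q) r) (∤-*+ q (s≤s z≤n) 1+r<p)
  ring : ∀ s a x → s * a * - x ≡ - s * (a * x)
  ring = solve-∀

∤⇒coprime : ∀ {p n} → Prime p → ¬ p ∣ n → Coprime p n
∤⇒coprime p-prime p∤n (d∣p , d∣n) with prime⇒irreducible p-prime d∣p
... | inj₁ d≡1  = d≡1
... | inj₂ refl = contradiction d∣n p∤n

coprime-^ : ∀ {m n} → Coprime m n → ∀ k → Coprime (m ^ k) n
coprime-^ m⊥n zero (d∣1 , _) = ℕ.∣1⇒≡1 d∣1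
coprime-^ {m} m⊥n (suc k) {d} (d∣m^[1+k] , d∣n) = coprime-^ m⊥n k (coprime-divisor d⊥m d∣m^[1+k] , d∣n)
  where
  d⊥m : Coprime d m
  d⊥m (e∣d , e∣m) = m⊥n (e∣m , ℕ.∣-trans e∣d d∣n)

-- An odd prime divides at most one of n and 2 + n, and the other one is then prime to p ^ k.
p^k∣n[2+n]⇒p^k∣n⊎p^k∣2+n : ∀ {p} → Prime p → p ≢ 2 → ∀ k {n} →
                            p ^ k ∣ n ℕ.* (2 ℕ.+ n) → p ^ k ∣ n ⊎ p ^ k ∣ 2 ℕ.+ n
p^k∣n[2+n]⇒p^k∣n⊎p^k∣2+n {p} p-prime p≢2 k {n} p^k∣n[2+n] with p ∣? n
... | no  p∤n = inj₂ (coprime-divisor (coprime-^ (∤⇒coprime p-prime p∤n) k) p^k∣n[2+n])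
... | yes p∣n = inj₁ (coprime-divisor (coprime-^ (∤⇒coprime p-prime p∤2+n) k)
                                      (subst (p ^ k ∣_) (ℕ.*-comm n (2 ℕ.+ n)) p^k∣n[2+n]))
  where
  p∤2+n : ¬ p ∣ 2 ℕ.+ n
  p∤2+n p∣2+n with irreducible[2] (∣m+n∣m⇒∣n (subst (p ∣_) (ℕ.+-comm 2 n) p∣2+n) p∣n)
  ... | inj₁ refl = contradiction p-prime (λ ())
  ... | inj₂ p≡2  = p≢2 p≡2

square≈1⇒≈±1 : ∀ {p} → Prime p → p ≢ 2 → ∀ k {x} → + x * + x ≈ + 1 [mod p ^ k ] →
               + x ≈ + 1 [mod p ^ k ] ⊎ + x ≈ - + 1 [mod p ^ k ]
square≈1⇒≈±1 p-prime p≢2 k {zero} 0≈1 = inj₁ 0≈1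
square≈1⇒≈±1 {p} p-prime p≢2 k {suc n} (mod d) =
  Sum.map (mod ∘ ℤ.∣ᵤ⇒∣) (mod ∘ ℤ.∣ᵤ⇒∣ ∘ subst (p ^ k ∣_) (ℕ.+-comm 1 (suc n)))
          (p^k∣n[2+n]⇒p^k∣n⊎p^k∣2+n p-prime p≢2 k (ℤ.∣⇒∣ᵤ (subst (+ (p ^ k) ℤ.∣_) square-1≡ d)))
  where
  square-1≡ : + suc n * + suc n - + 1 ≡ + (n ℕ.* (2 ℕ.+ n))
  square-1≡ = trans (ring (+ n)) (sym (ℤ.pos-* n (2 ℕ.+ n)))
    where
    ring : ∀ n → (+ 1 + n) * (+ 1 + n) - + 1 ≡ n * (+ 2 + n)
    ring = solve-∀

IsInverse : ℕ → ℕ → ℕ → Set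
IsInverse n x y = + x * + y ≈ + 1 [mod n ]

IsInverse-sym : ∀ {n} x y → IsInverse n x y → IsInverse n y x
IsInverse-sym x y = subst (_≈ + 1 [mod _ ]) (ℤ.*-comm (+ x) (+ y))

coprime⇒integer-inverse : ∀ {n x} → Coprime x n → ∃[ t ] + x * t ≈ + 1 [mod n ]
coprime⇒integer-inverse {n} {x} x⊥n with coprime-Bézout x⊥n
... | Bézout.+- a b 1+bn≡ax = + a , mod (ℤ.divides (+ b) (begin
  + x * + a - + 1           ≡⟨ cong (_- + 1) (trans (ℤ.*-comm (+ x) (+ a)) (sym (ℤ.pos-* a x))) ⟩
  + (a ℕ.* x) - + 1         ≡⟨ cong (λ m → + m - + 1) (sym 1+bn≡ax) ⟩
  + (1 ℕ.+ b ℕ.* n) - + 1   ≡⟨ cong (λ m → + 1 + m - + 1) (ℤ.pos-* b n) ⟩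
  + 1 + + b * + n - + 1     ≡⟨ ring (+ b * + n) ⟩
  + b * + n                 ∎))
  where
  open ≡-Reasoning
  ring : ∀ u → + 1 + u - + 1 ≡ u
  ring = solve-∀
... | Bézout.-+ a b 1+ax≡bn = - + a , mod (ℤ.divides (- + b) (begin
  + x * - + a - + 1         ≡⟨ ring (+ a) (+ x) ⟩
  - (+ 1 + + a * + x)       ≡⟨ cong (λ m → - (+ 1 + m)) (sym (ℤ.pos-* a x)) ⟩
  - + (1 ℕ.+ a ℕ.* x)       ≡⟨ cong (λ m → - + m) 1+ax≡bn ⟩
  - + (b ℕ.* n)             ≡⟨ cong -_ (ℤ.pos-* b n) ⟩
  - (+ b * + n)             ≡⟨ ℤ.neg-distribˡ-* (+ b) (+ n) ⟩
  - + b * + n               ∎))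
  where
  open ≡-Reasoning
  ring : ∀ a x → x * - a - + 1 ≡ - (+ 1 + a * x)
  ring = solve-∀

coprime⇒inverse : ∀ {n x} .{{_ : NonZero n}} → Coprime x n → ∃[ y ] y < n × IsInverse n x y
coprime⇒inverse {n} {x} x⊥n with coprime⇒integer-inverse x⊥n
... | t , xt≈1 = t %ℕ n , n%ℕd<d t n , ≈-trans (≈-*ˡ (+ x) (≈-%ℕ n t)) xt≈1

inverse-unique : ∀ {n x y z} → y < n → z < n → IsInverse n x y → IsInverse n x z → y ≡ z
inverse-unique {n} {x} {y} {z} y<n z<n xy≈1 xz≈1 = ≈-residue-unique y<n z<n (begin
  + y                 ≡⟨ sym (ℤ.*-identityʳ (+ y)) ⟩
  + y * + 1           ≈⟨ ≈-*ˡ (+ y) (≈-sym xz≈1) ⟩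
  + y * (+ x * + z)   ≡⟨ ring (+ x) (+ y) (+ z) ⟩
  + x * + y * + z     ≈⟨ ≈-*ʳ (+ z) xy≈1 ⟩
  + 1 * + z           ≡⟨ ℤ.*-identityˡ (+ z) ⟩
  + z                 ∎)
  where
  open ≈-Reasoning n
  ring : ∀ x y z → y * (x * z) ≡ x * y * z
  ring = solve-∀

inverse⇒∤ : ∀ {p n} x {y} → ¬ p ∣ 1 → p ∣ n → IsInverse n x y → ¬ p ∣ y
inverse⇒∤ {p} x {y} p∤1 p∣n xy≈1 p∣y = p∤1 (ℤ.∣⇒∣ᵤ (subst (+ p ℤ.∣_) (ring (+ x * + y)) p∣xy-[xy-1]))
  where
  p∣xy-[xy-1] : + p ℤ.∣ + x * + y - (+ x * + y - + 1)
  p∣xy-[xy-1] = ℤ.∣m∣n⇒∣m-n (ℤ.∣n⇒∣m*n (+ x) (ℤ.∣ᵤ⇒∣ p∣y)) (divides-difference (≈-weaken p∣n xy≈1))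
  ring : ∀ a → a - (a - + 1) ≡ + 1
  ring = solve-∀

_≢?_ : (y z : ℕ) → Dec (y ≢ z)
y ≢? z = ¬? (y ℕ.≟ z)

remove : ℕ → List ℕ → List ℕ
remove y = filter (y ≢?_)

product-remove : ∀ {y xs} → Unique xs → y ∈ xs → product xs ≡ y ℕ.* product (remove y xs)
product-remove {xs = x ∷ xs} (x≢xs ∷ _) (here refl) =
  cong (λ zs → x ℕ.* product zs) (sym (trans (filter-reject (x ≢?_) (λ x≢x → x≢x refl)) (filter-all (x ≢?_) x≢xs)))
product-remove {y} {x ∷ xs} (x≢xs ∷ unique) (there y∈xs) = begin
  x ℕ.* product xs                      ≡⟨ cong (x ℕ.*_) (product-remove unique y∈xs) ⟩
  x ℕ.* (y ℕ.* product (remove y xs))   ≡⟨ x∙yz≈y∙xz x y _ ⟩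
  y ℕ.* (x ℕ.* product (remove y xs))   ≡⟨ cong (λ zs → y ℕ.* product zs) (sym (filter-accept (y ≢?_) y≢x)) ⟩
  y ℕ.* product (remove y (x ∷ xs))     ∎
  where
  open ≡-Reasoning
  y≢x : y ≢ x
  y≢x y≡x = All.lookup x≢xs y∈xs (sym y≡x)

product-paired≈1 : ∀ {n} xs → Unique xs →
                   (∀ x {y z} → y ∈ xs → z ∈ xs → IsInverse n x y → IsInverse n x z → y ≡ z) →
                   (∀ {x} → x ∈ xs → ∃[ y ] y ∈ xs × y ≢ x × IsInverse n x y) →
                   + product xs ≈ + 1 [mod n ]
product-paired≈1 {n} xs = go xs (<-wellFounded (length xs))
  where
  go : ∀ xs → Acc _<_ (length xs) → Unique xs →
       (∀ x {y z} → y ∈ xs → z ∈ xs → IsInverse n x y → IsInverse n x z → y ≡ z) →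
       (∀ {x} → x ∈ xs → ∃[ y ] y ∈ xs × y ≢ x × IsInverse n x y) →
       + product xs ≈ + 1 [mod n ]
  go []       _        _                  _          _      = ≈-refl
  go (x ∷ xs) (acc rs) (x∉xs ∷ xs-unique) inv-unique paired with paired (here refl)
  ... | y , y∈x∷xs , y≢x , xy≈1 = begin
    + (x ℕ.* product xs)           ≡⟨ cong (λ m → + (x ℕ.* m)) (product-remove xs-unique y∈xs) ⟩
    + (x ℕ.* (y ℕ.* product ys))   ≡⟨ pos-** x y (product ys) ⟩
    + x * + y * + product ys       ≈⟨ ≈-* xy≈1 (go ys (rs (s≤s (length-filter (y ≢?_) xs))) (Unique.filter⁺ (y ≢?_) xs-unique)
                                                  ys-inverse-unique ys-paired) ⟩
    + 1 * + 1                      ∎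
    where
    open ≈-Reasoning n
    pos-** : ∀ a b c → + (a ℕ.* (b ℕ.* c)) ≡ + a * + b * + c
    pos-** a b c = trans (cong +_ (sym (ℕ.*-assoc a b c))) (trans (ℤ.pos-* (a ℕ.* b) c) (cong (_* + c) (ℤ.pos-* a b)))
    y∈xs = Any.tail y≢x y∈x∷xs
    ys = remove y xs
    ∈ys⇒∈xs : ∀ {z} → z ∈ ys → z ∈ xs
    ∈ys⇒∈xs z∈ys = proj₁ (∈-filter⁻ (y ≢?_) z∈ys)
    ys-inverse-unique : ∀ u {v w} → v ∈ ys → w ∈ ys → IsInverse n u v → IsInverse n u w → v ≡ w
    ys-inverse-unique u v∈ys w∈ys = inv-unique u (there (∈ys⇒∈xs v∈ys)) (there (∈ys⇒∈xs w∈ys))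
    ys-paired : ∀ {z} → z ∈ ys → ∃[ w ] w ∈ ys × w ≢ z × IsInverse n z w
    ys-paired {z} z∈ys with paired (there (∈ys⇒∈xs z∈ys))
    ... | w , w∈x∷xs , w≢z , zw≈1 = w , ∈-filter⁺ (y ≢?_) (Any.tail w≢x w∈x∷xs) y≢w , w≢z , zw≈1
      where
      z∈xs = ∈ys⇒∈xs z∈ys
      y≢z : y ≢ z
      y≢z = proj₂ (∈-filter⁻ (y ≢?_) {xs = xs} z∈ys)
      w≢x : w ≢ x
      w≢x refl = y≢z (inv-unique x y∈x∷xs (there z∈xs) xy≈1 (IsInverse-sym z x zw≈1))
      y≢w : y ≢ w
      y≢w refl = All.lookup x∉xs z∈xs
                   (sym (inv-unique y (there z∈xs) (here refl) (IsInverse-sym z y zw≈1) (IsInverse-sym x y xy≈1)))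

coprimesFrom2 : ℕ → ℕ → List ℕ
coprimesFrom2 p n = filter (λ x → ¬? (p ∣? x)) (applyDownFrom (2 ℕ.+_) n)

module _ (p : ℕ) where

  private
    p∤? : ∀ x → Dec (¬ p ∣ x)
    p∤? x = ¬? (p ∣? x)

  ∈-coprimesFrom2⁻ : ∀ n {x} → x ∈ coprimesFrom2 p n → ¬ p ∣ x × 2 ≤ x × x < 2 ℕ.+ n
  ∈-coprimesFrom2⁻ n x∈ with ∈-filter⁻ p∤? {xs = applyDownFrom (2 ℕ.+_) n} x∈
  ... | x∈range , p∤x with ∈-applyDownFrom⁻ (2 ℕ.+_) x∈range
  ...   | i , i<n , refl = p∤x , s≤s (s≤s z≤n) , s≤s (s≤s i<n)

  ∈-coprimesFrom2⁺ : ∀ n {x} → ¬ p ∣ x → 2 ≤ x → x < 2 ℕ.+ n → x ∈ coprimesFrom2 p n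
  ∈-coprimesFrom2⁺ n p∤x (s≤s (s≤s z≤n)) (s≤s (s≤s i<n)) = ∈-filter⁺ p∤? (∈-applyDownFrom⁺ (2 ℕ.+_) i<n) p∤x

  coprimesFrom2-unique : ∀ n → Unique (coprimesFrom2 p n)
  coprimesFrom2-unique n =
    Unique.filter⁺ p∤? (Unique.applyDownFrom⁺₁ (2 ℕ.+_) n (λ j<i _ → ℕ.<⇒≢ j<i ∘ sym ∘ ℕ.+-cancelˡ-≡ 2 _ _))

  prodCoprime≡product : ¬ p ∣ 1 → ∀ n → prodCoprime p (2 ℕ.+ n) ≡ + product (coprimesFrom2 p n)
  prodCoprime≡product p∤1 zero    = trans (prodCoprime-suc-∤ p∤1) (cong (_* + 1) (prodCoprime-suc-∣ (p ∣0)))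
  prodCoprime≡product p∤1 (suc n) = step (p ∣? 2 ℕ.+ n)
    where
    open ≡-Reasoning
    L = coprimesFrom2 p n
    step : Dec (p ∣ 2 ℕ.+ n) → prodCoprime p (3 ℕ.+ n) ≡ + product (coprimesFrom2 p (suc n))
    step (yes p∣2+n) = begin
      prodCoprime p (3 ℕ.+ n)               ≡⟨ prodCoprime-suc-∣ p∣2+n ⟩
      prodCoprime p (2 ℕ.+ n)               ≡⟨ prodCoprime≡product p∤1 n ⟩
      + product L                           ≡⟨ cong (+_ ∘ product) (sym (filter-reject p∤? (λ p∤2+n → p∤2+n p∣2+n))) ⟩
      + product (coprimesFrom2 p (suc n))   ∎
    step (no p∤2+n) = begin
      prodCoprime p (3 ℕ.+ n)               ≡⟨ prodCoprime-suc-∤ p∤2+n ⟩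
      prodCoprime p (2 ℕ.+ n) * + (2 ℕ.+ n) ≡⟨ cong (_* + (2 ℕ.+ n)) (prodCoprime≡product p∤1 n) ⟩
      + product L * + (2 ℕ.+ n)             ≡⟨ trans (ℤ.*-comm (+ product L) _) (sym (ℤ.pos-* (2 ℕ.+ n) (product L))) ⟩
      + product (2 ℕ.+ n ∷ L)               ≡⟨ cong (+_ ∘ product) (sym (filter-accept p∤? p∤2+n)) ⟩
      + product (coprimesFrom2 p (suc n))   ∎

-- Gauss's generalisation of Wilson's theorem: the units modulo M = p ^ (k + 1) other than ±1 pair off
-- with their distinct inverses, because ±1 are the only square roots of 1.
module Wilson {p} (p-prime : Prime p) (p≢2 : p ≢ 2) (k : ℕ) where

  private
    M m : ℕ
    M = p ^ suc k
    m = M ∸ 3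

    3≤M : 3 ≤ M
    3≤M = ℕ.≤-trans (ℕ.≤∧≢⇒< (ℕ.nonTrivial⇒n>1 p) (p≢2 ∘ sym)) (ℕ.m≤m*n p (p ^ k))
      where instance
      _ = prime⇒nonTrivial p-prime
      _ = prime⇒nonZero p-prime
      _ = ℕ.m^n≢0 p k

    M≡3+m : M ≡ 3 ℕ.+ m
    M≡3+m = sym (ℕ.m+[n∸m]≡n 3≤M)

    instance
      M-nonZero : NonZero M
      M-nonZero = ℕ.>-nonZero (ℕ.<-≤-trans (s≤s z≤n) 3≤M)

    ≤2+m⇒<M : ∀ {x} → x ≤ 2 ℕ.+ m → x < M
    ≤2+m⇒<M {x} x≤2+m = subst (x <_) (sym M≡3+m) (s≤s x≤2+m)

    p∣M : p ∣ M
    p∣M = m∣m*n (p ^ k)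

    p∤1 : ¬ p ∣ 1
    p∤1 p∣1 = ℕ.nonTrivial⇒≢1 {{prime⇒nonTrivial p-prime}} (ℕ.∣1⇒≡1 p∣1)

    p∤2+m : ¬ p ∣ 2 ℕ.+ m
    p∤2+m p∣2+m = p∤1 (∣m+n∣m⇒∣n (subst (p ∣_) (trans M≡3+m (ℕ.+-comm 1 (2 ℕ.+ m))) p∣M) p∣2+m)

    units : List ℕ
    units = coprimesFrom2 p m

    2+m≈-1 : + (2 ℕ.+ m) ≈ - + 1 [mod M ]
    2+m≈-1 = mod (ℤ.divides (+ 1) (trans (cong +_ (trans (ℕ.+-comm (2 ℕ.+ m) 1) (sym M≡3+m))) (sym (ℤ.*-identityˡ (+ M)))))

    ≉1 : ∀ {x} → 2 ≤ x → x < 2 ℕ.+ m → ¬ + x ≈ + 1 [mod M ]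
    ≉1 2≤x x<2+m x≈1 = ℕ.<⇒≢ 2≤x (sym (≈-residue-unique (≤2+m⇒<M (ℕ.<⇒≤ x<2+m)) (≤2+m⇒<M (s≤s z≤n)) x≈1))

    ≉-1 : ∀ {x} → x < 2 ℕ.+ m → ¬ + x ≈ - + 1 [mod M ]
    ≉-1 x<2+m x≈-1 =
      ℕ.<⇒≢ x<2+m (≈-residue-unique (≤2+m⇒<M (ℕ.<⇒≤ x<2+m)) (≤2+m⇒<M ℕ.≤-refl) (≈-trans x≈-1 (≈-sym 2+m≈-1)))

    inverse∈units : ∀ {x y} → x ∈ units → y < M → IsInverse M x y → y ∈ units
    inverse∈units {x} {y} x∈units y<M xy≈1 with ∈-coprimesFrom2⁻ p m x∈units
    ... | p∤x , 2≤x , x<2+m = ∈-coprimesFrom2⁺ p m (inverse⇒∤ x p∤1 p∣M xy≈1) (2≤y y xy≈1) y<2+m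
      where
      2≤y : ∀ y → IsInverse M x y → 2 ≤ y
      2≤y zero          x0≈1 = contradiction (≈-residue-unique (≤2+m⇒<M z≤n) (≤2+m⇒<M (s≤s z≤n))
                                                (subst (_≈ + 1 [mod M ]) (ℤ.*-zeroʳ (+ x)) x0≈1)) (λ ())
      2≤y (suc zero)    x1≈1 = contradiction (subst (_≈ + 1 [mod M ]) (ℤ.*-identityʳ (+ x)) x1≈1) (≉1 2≤x x<2+m)
      2≤y (suc (suc _)) _    = s≤s (s≤s z≤n)
      y≢2+m : y ≢ 2 ℕ.+ m
      y≢2+m refl = ≉-1 x<2+m (begin
        + x                     ≡⟨ ring (+ x) ⟩
        - (+ x * - + 1)         ≈⟨ ≈-neg (≈-*ˡ (+ x) (≈-sym 2+m≈-1)) ⟩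
        - (+ x * + (2 ℕ.+ m))   ≈⟨ ≈-neg xy≈1 ⟩
        - + 1                   ∎)
        where
        open ≈-Reasoning M
        ring : ∀ x → x ≡ - (x * - + 1)
        ring = solve-∀
      y<2+m : y < 2 ℕ.+ m
      y<2+m = ℕ.≤∧≢⇒< (ℕ.≤-pred (subst (y <_) M≡3+m y<M)) y≢2+m

    partner : ∀ {x} → x ∈ units → ∃[ y ] y ∈ units × y ≢ x × IsInverse M x y
    partner {x} x∈units with ∈-coprimesFrom2⁻ p m x∈units
    ... | p∤x , 2≤x , x<2+m = distinct (coprime⇒inverse (Coprime.sym (coprime-^ (∤⇒coprime p-prime p∤x) (suc k))))
      where
      distinct : ∃[ y ] y < M × IsInverse M x y → ∃[ y ] y ∈ units × y ≢ x × IsInverse M x y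
      distinct (y , y<M , xy≈1) = y , inverse∈units {x} {y} x∈units y<M xy≈1 , y≢x , xy≈1
        where
        y≢x : y ≢ x
        y≢x refl = [ ≉1 2≤x x<2+m , ≉-1 x<2+m ]′ (square≈1⇒≈±1 p-prime p≢2 (suc k) {x} xy≈1)

    units-inverse-unique : ∀ x {y z} → y ∈ units → z ∈ units → IsInverse M x y → IsInverse M x z → y ≡ z
    units-inverse-unique x y∈units z∈units = inverse-unique {x = x} (<M y∈units) (<M z∈units)
      where
      <M : ∀ {y} → y ∈ units → y < M
      <M y∈units = ≤2+m⇒<M (ℕ.<⇒≤ (proj₂ (proj₂ (∈-coprimesFrom2⁻ p m y∈units))))

  prodCoprime≈-1 : prodCoprime p M ≈ - + 1 [mod M ]
  prodCoprime≈-1 = begin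
    prodCoprime p M                         ≡⟨ cong (prodCoprime p) M≡3+m ⟩
    prodCoprime p (3 ℕ.+ m)                 ≡⟨ prodCoprime-suc-∤ p∤2+m ⟩
    prodCoprime p (2 ℕ.+ m) * + (2 ℕ.+ m)   ≡⟨ cong (_* + (2 ℕ.+ m)) (prodCoprime≡product p p∤1 m) ⟩
    + product units * + (2 ℕ.+ m)           ≈⟨ ≈-* (product-paired≈1 units (coprimesFrom2-unique p m) units-inverse-unique partner)
                                                   2+m≈-1 ⟩
    + 1 * - + 1                             ∎
    where open ≈-Reasoning M

odd⇒≡1+2h : ∀ n → ¬ 2 ∣ n → ∃[ h ] n ≡ suc (2 ℕ.* h)
odd⇒≡1+2h zero          2∤0   = contradiction (2 ∣0) 2∤0
odd⇒≡1+2h (suc zero)    _     = 0 , refl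
odd⇒≡1+2h (suc (suc n)) 2∤2+n with odd⇒≡1+2h n (2∤2+n ∘ ℕ.∣m∣n⇒∣m+n ℕ.∣-refl)
... | h , refl = suc h , cong (suc ∘ suc) (sym (ℕ.+-suc h (h ℕ.+ 0)))

prime≢2⇒2∤ : ∀ {p} → Prime p → p ≢ 2 → ¬ 2 ∣ p
prime≢2⇒2∤ p-prime p≢2 2∣p with prime⇒irreducible p-prime 2∣p
... | inj₁ ()
... | inj₂ 2≡p = p≢2 (sym 2≡p)

odd-prime≡1+2h : ∀ {p} → Prime p → p ≢ 2 → p ≡ suc (2 ℕ.* ((p ∸ 1) / 2))
odd-prime≡1+2h {p} p-prime p≢2 with odd⇒≡1+2h p (prime≢2⇒2∤ p-prime p≢2)
... | h , refl = cong (suc ∘ (2 ℕ.*_)) (sym (trans (cong (_/ 2) (ℕ.*-comm 2 h)) (m*n/n≡m h 2)))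

odd-^ : ∀ {p h} → p ≡ suc (2 ℕ.* h) → ∀ n → ∃[ q ] p ^ n ≡ suc (2 ℕ.* q)
odd-^ p≡ zero = 0 , refl
odd-^ {h = h} refl (suc n) with odd-^ {h = h} refl n
... | q , eq = h ℕ.+ q ℕ.+ 2 ℕ.* h ℕ.* q , trans (cong (suc (2 ℕ.* h) ℕ.*_) eq) (ring h q)
  where
  ring : ∀ h q → suc (2 ℕ.* h) ℕ.* suc (2 ℕ.* q) ≡ suc (2 ℕ.* (h ℕ.+ q ℕ.+ 2 ℕ.* h ℕ.* q))
  ring = ℕ-Solver.solve-∀

^-half-split : ∀ {p h q} → p ≡ suc (2 ℕ.* h) → ∀ k → p ^ k ≡ suc (2 ℕ.* q) →
               let e = p ℕ.* q ℕ.+ h in suc e ℕ.+ e ≡ p ^ suc k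
^-half-split {p} {h} {q} p≡ k p^k≡ =
  trans (subst (λ p → suc (p ℕ.* q ℕ.+ h) ℕ.+ (p ℕ.* q ℕ.+ h) ≡ p ℕ.* suc (2 ℕ.* q)) (sym p≡) (ring h q))
        (cong (p ℕ.*_) (sym p^k≡))
  where
  ring : ∀ h q → let p = suc (2 ℕ.* h) in suc (p ℕ.* q ℕ.+ h) ℕ.+ (p ℕ.* q ℕ.+ h) ≡ p ℕ.* suc (2 ℕ.* q)
  ring = ℕ-Solver.solve-∀

halfSeq≡ : ∀ {p h q} → p ≡ suc (2 ℕ.* h) → ∀ k → p ^ k ≡ suc (2 ℕ.* q) →
           ∀ j → halfSeq p j (suc k) ≡ suc (p ℕ.* q ℕ.+ h) ℕ.+ j
halfSeq≡ {p} {h} {q} p≡ k p^k≡ j = begin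
  j ℕ.+ (p ^ suc k ℕ.+ 1) / 2     ≡⟨ cong (λ n → j ℕ.+ (n ℕ.+ 1) / 2) (sym (^-half-split p≡ k p^k≡)) ⟩
  j ℕ.+ (suc e ℕ.+ e ℕ.+ 1) / 2   ≡⟨ cong (λ n → j ℕ.+ n / 2) (ring e) ⟩
  j ℕ.+ (suc e ℕ.* 2) / 2         ≡⟨ cong (j ℕ.+_) (m*n/n≡m (suc e) 2) ⟩
  j ℕ.+ suc e                     ≡⟨ ℕ.+-comm j (suc e) ⟩
  suc e ℕ.+ j                     ∎
  where
  open ≡-Reasoning
  e = p ℕ.* q ℕ.+ h
  ring : ∀ e → suc e ℕ.+ e ℕ.+ 1 ≡ suc e ℕ.* 2
  ring = ℕ-Solver.solve-∀

prodCoprime-half-square : ∀ {p h q} → Prime p → p ≡ suc (2 ℕ.* h) → ∀ k → p ^ k ≡ suc (2 ℕ.* q) →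
                          let P½ = prodCoprime p (suc (p ℕ.* q ℕ.+ h)) in P½ * P½ ≈ - negOnePow h [mod p ^ suc k ]
prodCoprime-half-square {p} {h} {q} p-prime p≡ k p^k≡ = begin
  P½ * P½                               ≡⟨ sym (trans (cong (_* (P½ * P½)) (negOnePow-square h)) (ℤ.*-identityˡ _)) ⟩
  s * s * (P½ * P½)                     ≡⟨ ring s P½ ⟩
  s * (P½ * (s * P½))                   ≡⟨ cong (λ x → s * (P½ * x)) (sym (prodCoprimeNeg-odd {h = h} p≡ q h h<p)) ⟩
  s * (P½ * prodCoprimeNeg p (suc e))   ≈⟨ ≈-*ˡ s (≈-sym (prodCoprime-reflect {p} p∣p^[1+k] (suc e) e (^-half-split p≡ k p^k≡))) ⟩
  s * prodCoprime p (p ^ suc k)         ≈⟨ ≈-*ˡ s (Wilson.prodCoprime≈-1 p-prime p≢2 k) ⟩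
  s * - + 1                             ≡⟨ trans (ℤ.*-comm s (- + 1)) (ℤ.-1*i≡-i s) ⟩
  - s                                   ∎
  where
  open ≈-Reasoning (p ^ suc k)
  e = p ℕ.* q ℕ.+ h
  s = negOnePow h
  P½ = prodCoprime p (suc e)
  h<p : h < p
  h<p = subst (h <_) (sym p≡) (s≤s (ℕ.m≤m+n h (h ℕ.+ 0)))
  p≢2 : p ≢ 2
  p≢2 p≡2 = ℕ.even≢odd 1 h (trans (sym p≡2) p≡)
  p∣p^[1+k] : p ∣ p ^ suc k
  p∣p^[1+k] = m∣m*n (p ^ k)
  ring : ∀ s x → s * s * (x * x) ≡ s * (x * (s * x))
  ring = solve-∀

-- Writing x = p q + y, one has x ^ 2 + y (p - y) = p ^ 2 q ^ 2 + p y (1 + 2 q).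
square≈-reflection : ∀ p (q y : ℤ) → + p ℤ.∣ + 1 + + 2 * q →
                     (+ p * q + y) * (+ p * q + y) ≈ - + 1 * y * (+ p - y) [mod p ^ 2 ]
square≈-reflection p q y p∣1+2q = mod (subst₂ ℤ._∣_ p*p≡p^2 (sym (ring (+ p) q y))
  (ℤ.∣m∣n⇒∣m+n (ℤ.∣m⇒∣m*n (q * q) ℤ.∣-refl) (ℤ.*-monoʳ-∣ (+ p) (ℤ.∣n⇒∣m*n y p∣1+2q))))
  where
  p*p≡p^2 : + p * + p ≡ + (p ^ 2)
  p*p≡p^2 = trans (sym (ℤ.pos-* p p)) (cong (λ n → + (p ℕ.* n)) (sym (ℕ.*-identityʳ p)))
  ring : ∀ p q y → (p * q + y) * (p * q + y) - - + 1 * y * (p - y) ≡ p * p * (q * q) + p * (y * (+ 1 + + 2 * q))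
  ring = solve-∀

Π-square-reflection : ∀ {p h q} → p ≡ suc (2 ℕ.* h) → p ∣ suc (2 ℕ.* q) → ∀ {j} → j ≤ h →
  negOnePow j * Π j (λ i → + (suc h ℕ.+ i)) * Π j (λ i → + (h ∸ i))
    ≈ Π j (λ i → + (suc (p ℕ.* q ℕ.+ h) ℕ.+ i)) * Π j (λ i → + (suc (p ℕ.* q ℕ.+ h) ℕ.+ i)) [mod p ^ 2 ]
Π-square-reflection {p} {h} {q} p≡ p∣1+2q {j} j≤h = begin
  negOnePow j * Π j y * Π j (λ i → + (h ∸ i))         ≡⟨ cong (λ s → s * Π j y * Π j (λ i → + (h ∸ i))) (negOnePow≡Π j) ⟩
  Π j (λ _ → - + 1) * Π j y * Π j (λ i → + (h ∸ i))   ≡⟨ cong (_* Π j (λ i → + (h ∸ i))) (Π-* j _ y) ⟩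
  Π j (λ i → - + 1 * y i) * Π j (λ i → + (h ∸ i))     ≡⟨ Π-* j _ _ ⟩
  Π j (λ i → - + 1 * y i * + (h ∸ i))                 ≈⟨ Π-cong-≈ j factor ⟩
  Π j (λ i → x i * x i)                               ≡⟨ sym (Π-* j x x) ⟩
  Π j x * Π j x                                       ∎
  where
  open ≈-Reasoning (p ^ 2)
  y x : ℕ → ℤ
  y i = + (suc h ℕ.+ i)
  x i = + (suc (p ℕ.* q ℕ.+ h) ℕ.+ i)
  factor : ∀ i → i < j → - + 1 * y i * + (h ∸ i) ≈ x i * x i [mod p ^ 2 ]
  factor i i<j = ≈-sym (subst₂ (λ a b → a * a ≈ - + 1 * y i * b [mod p ^ 2 ]) pq+y≡x p-y≡h∸i
                                (square≈-reflection p (+ q) (y i) p∣1+2q′))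
    where
    p∣1+2q′ : + p ℤ.∣ + 1 + + 2 * + q
    p∣1+2q′ = subst (+ p ℤ.∣_) (cong (λ n → + 1 + n) (ℤ.pos-* 2 q)) (ℤ.∣ᵤ⇒∣ p∣1+2q)
    pq+y≡x : + p * + q + y i ≡ x i
    pq+y≡x = trans (cong (_+ y i) (sym (ℤ.pos-* p q)))
                   (cong +_ (trans (ℕ.+-suc (p ℕ.* q) (h ℕ.+ i)) (cong suc (sym (ℕ.+-assoc (p ℕ.* q) h i)))))
    p≡[h∸i]+y : p ≡ (h ∸ i) ℕ.+ (suc h ℕ.+ i)
    p≡[h∸i]+y = trans p≡ (subst (λ h′ → suc (2 ℕ.* h′) ≡ (h ∸ i) ℕ.+ (suc h′ ℕ.+ i))
                                (ℕ.m∸n+n≡m (ℕ.<⇒≤ (ℕ.<-≤-trans i<j j≤h))) (ring (h ∸ i) i))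
      where
      ring : ∀ d i → suc (2 ℕ.* (d ℕ.+ i)) ≡ d ℕ.+ (suc (d ℕ.+ i) ℕ.+ i)
      ring = ℕ-Solver.solve-∀
    p-y≡h∸i : + p - y i ≡ + (h ∸ i)
    p-y≡h∸i = trans (cong (λ n → + n - y i) p≡[h∸i]+y) (ring (+ (h ∸ i)) (y i))
      where
      ring : ∀ a b → a + b - b ≡ a
      ring = solve-∀

prodCoprime-above-half : ∀ {p h} q → p ≡ suc (2 ℕ.* h) → ∀ {j} → j ≤ h →
  let e = p ℕ.* q ℕ.+ h in prodCoprime p (suc e ℕ.+ j) ≡ prodCoprime p (suc e) * Π j (λ i → + (suc e ℕ.+ i))
prodCoprime-above-half {p} {h} q p≡ {j} j≤h = prodCoprime-+ (suc (p ℕ.* q ℕ.+ h)) j p∤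
  where
  p∤ : ∀ i → i < j → ¬ p ∣ suc (p ℕ.* q ℕ.+ h) ℕ.+ i
  p∤ i i<j = subst (λ n → ¬ p ∣ n) (trans (ℕ.+-suc (p ℕ.* q) (h ℕ.+ i)) (cong suc (sym (ℕ.+-assoc (p ℕ.* q) h i))))
                   (∤-*+ q (s≤s z≤n) (subst (suc h ℕ.+ i <_) (sym p≡)
                                             (s≤s (ℕ.+-monoʳ-< h (ℕ.<-≤-trans i<j (ℕ.≤-trans j≤h (ℕ.m≤m+n h 0)))))))

Γp-half-square : ∀ {p h j} → Prime p → p ≡ suc (2 ℕ.* h) → j ≤ h → ∀ k →
  (- (negOnePow h * negOnePow j * + ((h ℕ.+ j) C j) * + (h C j))) * (Γp p (1 ℕ.+ j) * Γp p (1 ℕ.+ j))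
    ≈ Γp p (halfSeq p j (2 ℕ.+ k)) * Γp p (halfSeq p j (2 ℕ.+ k)) [mod p ^ 2 ]
Γp-half-square {p} {h} {j} p-prime p≡ j≤h k = begin
  - (s * ε * c₁ * c₂) * (Γp p (1 ℕ.+ j) * Γp p (1 ℕ.+ j))             ≡⟨ cong (- (s * ε * c₁ * c₂) *_) Γp[1+j]²≡ ⟩
  - (s * ε * c₁ * c₂) * (+ (j !) * + (j !))                           ≡⟨ ring s ε c₁ c₂ (+ (j !)) ⟩
  - s * (ε * (c₁ * + (j !)) * (c₂ * + (j !)))                         ≡⟨ cong₂ (λ a b → - s * (ε * a * b)) (C*!≡Π-rising h j) (C*!≡Π-falling j≤h) ⟩
  - s * (ε * Π j (λ i → + (suc h ℕ.+ i)) * Π j (λ i → + (h ∸ i)))     ≈⟨ ≈-*ˡ (- s) (Π-square-reflection p≡ p∣1+2q j≤h) ⟩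
  - s * (A * A)                                                       ≈⟨ ≈-*ʳ (A * A) (≈-sym P½²≈-s) ⟩
  P½ * P½ * (A * A)                                                   ≡⟨ ring′ P½ A ⟩
  P½ * A * (P½ * A)                                                   ≡⟨ cong (λ x → x * x) (sym (prodCoprime-above-half q p≡ j≤h)) ⟩
  prodCoprime p (suc e ℕ.+ j) * prodCoprime p (suc e ℕ.+ j)           ≡⟨ sym (Γp-square p (suc e ℕ.+ j)) ⟩
  Γp p (suc e ℕ.+ j) * Γp p (suc e ℕ.+ j)                             ≡⟨ cong (λ n → Γp p n * Γp p n) (sym N≡) ⟩
  Γp p N * Γp p N                                                     ∎
  where
  open ≈-Reasoning (p ^ 2)
  s = negOnePow h
  ε = negOnePow j
  c₁ = + ((h ℕ.+ j) C j)
  c₂ = + (h C j)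
  q = proj₁ (odd-^ {h = h} p≡ (suc k))
  p^[1+k]≡ : p ^ suc k ≡ suc (2 ℕ.* q)
  p^[1+k]≡ = proj₂ (odd-^ {h = h} p≡ (suc k))
  p∣1+2q : p ∣ suc (2 ℕ.* q)
  p∣1+2q = subst (p ∣_) p^[1+k]≡ (m∣m*n (p ^ k))
  e = p ℕ.* q ℕ.+ h
  N = halfSeq p j (2 ℕ.+ k)
  N≡ : N ≡ suc e ℕ.+ j
  N≡ = halfSeq≡ p≡ (suc k) p^[1+k]≡ j
  P½ = prodCoprime p (suc e)
  A = Π j (λ i → + (suc e ℕ.+ i))
  P½²≈-s : P½ * P½ ≈ - s [mod p ^ 2 ]
  P½²≈-s = ≈-weaken (subst (p ^ 2 ∣_) (sym (ℕ.^-distribˡ-+-* p 2 k)) (m∣m*n (p ^ k)))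
                    (prodCoprime-half-square p-prime p≡ (suc k) p^[1+k]≡)
  Γp[1+j]²≡ : Γp p (1 ℕ.+ j) * Γp p (1 ℕ.+ j) ≡ + (j !) * + (j !)
  Γp[1+j]²≡ = trans (Γp-square p (1 ℕ.+ j)) (cong (λ x → x * x) (prodCoprime≡! j<p))
    where
    j<p : j < p
    j<p = subst (j <_) (sym p≡) (s≤s (ℕ.≤-trans j≤h (ℕ.m≤m+n h (h ℕ.+ 0))))
  ring : ∀ s ε c₁ c₂ f → - (s * ε * c₁ * c₂) * (f * f) ≡ - s * (ε * (c₁ * f) * (c₂ * f))
  ring = solve-∀
  ring′ : ∀ a b → a * a * (b * b) ≡ a * b * (a * b)
  ring′ = solve-∀

-- The congruence holds for j = 0 as well.
lemma2p3 : (p j : ℕ) → Prime p → p ≢ 2 → 1 ≤ j → j ≤ (p ∸ 1) / 2 →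
    ∃ λ K → (k : ℕ) → k ≥ K →
      ((- (negOnePow ((p ∸ 1) / 2) ℤ.* negOnePow j
           ℤ.* (+ ((((p ∸ 1) / 2) ℕ.+ j) C j)) ℤ.* (+ (((p ∸ 1) / 2) C j))))
        ℤ.* (Γp p (1 ℕ.+ j) ℤ.* Γp p (1 ℕ.+ j)))
      ≡ (Γp p (halfSeq p j k) ℤ.* Γp p (halfSeq p j k)) [mod p ^ 2 ]
lemma2p3 p j p-prime p≢2 _ j≤h = 2 , λ where
  _ (s≤s (s≤s (z≤n {k}))) → ≈⇒≡[mod] (Γp-half-square p-prime (odd-prime≡1+2h p-prime p≢2) j≤h k)
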